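{- Let $\nu$ be a strict partition and fix $1\le a\le\ell(\nu)$. Let $(\alpha,\beta)$ and $(\alpha',\beta')$ be two pairs of partitions with $\ell(\alpha)<a$ and $\beta_1<\nu_a$. If the extension of $\nu$ by $(\alpha,\beta)$ coincides with the extension of $\nu$ by $(\alpha',\beta')$, then $(\alpha,\beta)=(\alpha',\beta')$.
   Context: A partition is an infinite weakly decreasing sequence $\mu_1\ge\mu_2\ge\cdots$ of nonnegative integers with finitely many nonzero terms; $\ell(\mu)$ is its number of nonzero parts, and it is strict if its nonzero parts are pairwise distinct. For partitions $\nu,\alpha,\beta$, the extension of $\nu$ by the pair $(\alpha,\beta)$ is the partition obtained by first adding the columns of $\alpha$ as new columns to the Ferrers board of $\nu$ (giving the partition $\nu+\alpha$ with parts $\nu_i+\alpha_i$) and then adding the rows of $\beta$ as new rows; i.e. its multiset of nonzero parts is the union of the multiset of nonzero values $\nu_i+\alpha_i$ ($i\ge1$) and the multiset of nonzero parts of $\beta$. -}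

module Defs where

open import Data.Nat using (ℕ; zero; suc; _+_; _<_; _≥_; _>_)
open import Data.List using (List; []; _∷_; _++_; length)
open import Data.List.Relation.Unary.All using (All)
open import Data.List.Relation.Unary.Linked using (Linked)

-- A partition, represented by the finite list of its nonzero parts
-- (μ₁ ≥ μ₂ ≥ ⋯ > 0); all further parts are implicitly 0.
record Partition : Set where
  constructor mkPartition
  field
    parts    : List ℕ
    weaklyDecreasing : Linked _≥_ parts
    positive : All (0 <_) parts
open Partition public

ℓ : Partition → ℕ
ℓ μ = length (parts μ)

-- 1-indexed part μ_i (equal to 0 for i > ℓ(μ); index 0 is unused and gives 0)
partAt : List ℕ → ℕ → ℕ
partAt []       _             = 0
partAt (x ∷ xs) zero          = 0
partAt (x ∷ xs) (suc zero)    = x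
partAt (x ∷ xs) (suc (suc i)) = partAt xs (suc i)

_⟨_⟩ : Partition → ℕ → ℕ
μ ⟨ i ⟩ = partAt (parts μ) i

Strict : Partition → Set
Strict μ = Linked _>_ (parts μ)

addParts : List ℕ → List ℕ → List ℕ
addParts []       ys       = ys
addParts xs       []       = xs
addParts (x ∷ xs) (y ∷ ys) = (x + y) ∷ addParts xs ys

-- the list of nonzero parts of the extension of ν by (α, β):
-- the nonzero values ν_i + α_i, followed by the nonzero parts of β.
-- (As a multiset this determines the extension partition.)
extensionParts : Partition → Partition → Partition → List ℕ
extensionParts ν α β = addParts (parts ν) (parts α) ++ parts β

module Submission where

open import Defs
open import Data.Nat using (ℕ; _≤_; _<_)
open import Data.Product using (_×_)
open import Relation.Binary.PropositionalEquality using (_≡_)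
open import Data.List.Relation.Binary.Permutation.Propositional using (_↭_)

-- Put v = ν_a.  Because ℓ(α) < a, every part ν_i + α_i that
-- actually receives a column of α sits at an index i < a, so it is ≥ ν_i ≥ v;
-- and every part of β is < v.  Hence the parts of the extension that are < v
-- are exactly (the parts < v of ν) followed by β, independently of α.
-- Filtering the given permutation by "< v" and cancelling the common prefix
-- gives β ↭ β′, and since both are weakly decreasing, β = β′.  Cancelling β
-- from the permutation gives ν + α ↭ ν + α′; both lists are weakly decreasing,
-- so ν + α = ν + α′, and adding the positive parts of α is injective.

open import Data.Nat using (zero; suc; _+_; _≥_; z≤n; s≤s; _<?_)
open import Data.Nat.Properties
  using (≤-refl; ≤-trans; ≤-<-trans; ≤⇒≯; m≤m+n; m≤n+m; +-mono-≤; m<m+n; <⇒≢;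
         +-cancelˡ-≡; <⇒≤; ≤-totalOrder)
open import Data.List using (List; []; _∷_; _++_; length; take; filter)
open import Data.List.Properties using (∷-injective; filter-++; filter-reject; filter-all)
open import Data.List.Relation.Unary.All using (All; []; _∷_)
import Data.List.Relation.Unary.All as All
open import Data.List.Relation.Unary.Linked using (Linked; []; [-]; _∷_)
import Data.List.Relation.Unary.Linked.Properties as Linked
open import Data.List.Relation.Binary.Permutation.Propositional
  using (↭-trans; ↭-reflexive; ↭⇒↭ₛ′)
open import Data.List.Relation.Binary.Permutation.Propositional.Properties
  using (drop-∷; ++-comm; filter-↭)
open import Data.List.Relation.Unary.Sorted.TotalOrder.Properties using (↗↭↗⇒≋)
import Data.List.Relation.Binary.Pointwise as Pointwise
import Relation.Binary.Construct.Flip.Ord as Flip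
open import Relation.Binary.Bundles using (TotalOrder)
open import Relation.Binary.PropositionalEquality using (refl; sym; cong; cong₂; module ≡-Reasoning)
open import Data.Product using (_,_; proj₁)
open import Data.Empty using (⊥-elim)

-- ℕ ordered by ≥; weakly decreasing lists are exactly the lists sorted for it.
≥-totalOrder : TotalOrder _ _ _
≥-totalOrder = Flip.totalOrder ≤-totalOrder

decreasing-↭⇒≡ : ∀ {xs ys : List ℕ} → Linked _≥_ xs → Linked _≥_ ys → xs ↭ ys → xs ≡ ys
decreasing-↭⇒≡ xs↘ ys↘ xs↭ys = Pointwise.Pointwise-≡⇒≡ (Pointwise.map sym
  (↗↭↗⇒≋ ≥-totalOrder xs↘ ys↘ (↭⇒↭ₛ′ (TotalOrder.isEquivalence ≥-totalOrder) xs↭ys)))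

↭-cancelˡ : ∀ {A : Set} (xs : List A) {ys zs} → xs ++ ys ↭ xs ++ zs → ys ↭ zs
↭-cancelˡ []       p = p
↭-cancelˡ (x ∷ xs) p = ↭-cancelˡ xs (drop-∷ p)

↭-cancelʳ : ∀ {A : Set} (zs : List A) {xs ys} → xs ++ zs ↭ ys ++ zs → xs ↭ ys
↭-cancelʳ zs {xs} {ys} p = ↭-cancelˡ zs (↭-trans (++-comm zs xs) (↭-trans p (++-comm ys zs)))

addParts-identityʳ : ∀ ns → addParts ns [] ≡ ns
addParts-identityʳ []       = refl
addParts-identityʳ (_ ∷ _)  = refl

addParts-decreasing : ∀ {ns xs} → Linked _≥_ ns → Linked _≥_ xs → Linked _≥_ (addParts ns xs)
addParts-decreasing {[]}     _  xs↘ = xs↘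
addParts-decreasing {_ ∷ _}  {[]} ns↘ _ = ns↘
addParts-decreasing {_ ∷ _} {_ ∷ _} ns↘ xs↘ = cons ns↘ xs↘
  where
  -- the nonempty case, generalised over the heads so the induction goes through
  cons : ∀ {n x ns xs} → Linked _≥_ (n ∷ ns) → Linked _≥_ (x ∷ xs) →
         Linked _≥_ ((n + x) ∷ addParts ns xs)
  cons {ns = []}    {[]}    _        _        = [-]
  cons {n} {x} {[]} {_ ∷ _} _        (x≥y ∷ l) = ≤-trans x≥y (m≤n+m x n) ∷ l
  cons {n} {x} {_ ∷ _} {[]} (n≥m ∷ l) _        = ≤-trans n≥m (m≤m+n n x) ∷ l
  cons {ns = _ ∷ _} {_ ∷ _} (n≥m ∷ l) (x≥y ∷ l′) = +-mono-≤ n≥m x≥y ∷ cons l l′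

-- Adding a list of positive parts is injective: a positive part cannot hide.
addParts-injective : ∀ ns {xs ys} → All (0 <_) xs → All (0 <_) ys →
                     addParts ns xs ≡ addParts ns ys → xs ≡ ys
addParts-injective []       _          _          e = e
addParts-injective (_ ∷ _)  {[]}     {[]}     _          _          _ = refl
addParts-injective (n ∷ _)  {[]}     {_ ∷ _}  _          (0<y ∷ _)  e =
  ⊥-elim (<⇒≢ (m<m+n n 0<y) (proj₁ (∷-injective e)))
addParts-injective (n ∷ _)  {_ ∷ _}  {[]}     (0<x ∷ _)  _          e =
  ⊥-elim (<⇒≢ (m<m+n n 0<x) (sym (proj₁ (∷-injective e))))
addParts-injective (n ∷ ns) {x ∷ xs} {y ∷ ys} (_ ∷ xs⁺) (_ ∷ ys⁺) e
  with ∷-injective e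
... | head≡ , tail≡ = cong₂ _∷_ (+-cancelˡ-≡ n x y head≡) (addParts-injective ns xs⁺ ys⁺ tail≡)

prefix-≥ : ∀ {ns} a → Linked _≥_ ns → 1 ≤ a → a ≤ length ns →
           All (partAt ns a ≤_) (take a ns)
prefix-≥ {_ ∷ []}    (suc zero)    _          _ _                 = ≤-refl ∷ []
prefix-≥ {_ ∷ _ ∷ _} (suc zero)    _          _ _                 = ≤-refl ∷ []
prefix-≥ {_ ∷ []}    (suc (suc _)) _          _ (s≤s ())
prefix-≥ {_ ∷ _ ∷ _} (suc (suc j)) (n≥m ∷ l)  _ (s≤s a≤)
  with prefix-≥ (suc j) l (s≤s z≤n) a≤
... | p≤m ∷ rest = ≤-trans p≤m n≥m ∷ p≤m ∷ rest

parts-< : ∀ {v bs} → Linked _≥_ bs → partAt bs 1 < v → All (_< v) bs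
parts-< {bs = []}    _   _     = []
parts-< {bs = _ ∷ _} bs↘ b₁<v =
  All.map (λ b≤b₁ → ≤-<-trans b≤b₁ b₁<v) (Linked.Linked⇒All (λ p q → ≤-trans q p) ≤-refl bs↘)

addParts-below : ∀ {v} k ns xs → length xs ≤ k → k ≤ length ns → All (v ≤_) (take k ns) →
                 filter (_<? v) (addParts ns xs) ≡ filter (_<? v) ns
addParts-below k ns [] _ _ _ = cong (filter _) (addParts-identityʳ ns)
addParts-below {v} (suc k) (n ∷ ns) (x ∷ xs) (s≤s xs≤k) (s≤s k≤ns) (v≤n ∷ rest) = begin
  filter (_<? v) ((n + x) ∷ addParts ns xs) ≡⟨ filter-reject (_<? v) (≤⇒≯ (≤-trans v≤n (m≤m+n n x))) ⟩
  filter (_<? v) (addParts ns xs)           ≡⟨ addParts-below k ns xs xs≤k k≤ns rest ⟩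
  filter (_<? v) ns                         ≡⟨ sym (filter-reject (_<? v) (≤⇒≯ v≤n)) ⟩
  filter (_<? v) (n ∷ ns)                   ∎
  where open ≡-Reasoning

extension-below : ∀ {v} k (ν α β : Partition) → ℓ α ≤ k → k ≤ ℓ ν →
                  All (v ≤_) (take k (parts ν)) → All (_< v) (parts β) →
                  filter (_<? v) (extensionParts ν α β) ≡ filter (_<? v) (parts ν) ++ parts β
extension-below {v} k ν α β α≤k k≤ν top β<v = begin
  filter (_<? v) (addParts (parts ν) (parts α) ++ parts β)
    ≡⟨ filter-++ (_<? v) (addParts (parts ν) (parts α)) (parts β) ⟩
  filter (_<? v) (addParts (parts ν) (parts α)) ++ filter (_<? v) (parts β)
    ≡⟨ cong₂ _++_ (addParts-below k (parts ν) (parts α) α≤k k≤ν top) (filter-all (_<? v) β<v) ⟩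
  filter (_<? v) (parts ν) ++ parts β ∎
  where open ≡-Reasoning

lemma5 : (ν : Partition) → Strict ν → (a : ℕ) → 1 ≤ a → a ≤ ℓ ν →
    (α β α′ β′ : Partition) →
    ℓ α < a → β ⟨ 1 ⟩ < ν ⟨ a ⟩ →
    ℓ α′ < a → β′ ⟨ 1 ⟩ < ν ⟨ a ⟩ →
    extensionParts ν α β ↭ extensionParts ν α′ β′ →
    (parts α ≡ parts α′) × (parts β ≡ parts β′)
lemma5 ν _ a 1≤a a≤ℓν α β α′ β′ ℓα<a β₁<νa ℓα′<a β′₁<νa ext↭ = α≡α′ , β≡β′
  where
  v = ν ⟨ a ⟩
  top : All (v ≤_) (take a (parts ν))
  top = prefix-≥ a (weaklyDecreasing ν) 1≤a a≤ℓν
  low≡ : filter (_<? v) (extensionParts ν α β) ≡ filter (_<? v) (parts ν) ++ parts β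
  low≡ = extension-below a ν α β (<⇒≤ ℓα<a) a≤ℓν top (parts-< (weaklyDecreasing β) β₁<νa)
  low≡′ : filter (_<? v) (extensionParts ν α′ β′) ≡ filter (_<? v) (parts ν) ++ parts β′
  low≡′ = extension-below a ν α′ β′ (<⇒≤ ℓα′<a) a≤ℓν top (parts-< (weaklyDecreasing β′) β′₁<νa)
  β↭β′ : parts β ↭ parts β′
  β↭β′ = ↭-cancelˡ (filter (_<? v) (parts ν))
    (↭-trans (↭-reflexive (sym low≡)) (↭-trans (filter-↭ (_<? v) ext↭) (↭-reflexive low≡′)))
  β≡β′ : parts β ≡ parts β′
  β≡β′ = decreasing-↭⇒≡ (weaklyDecreasing β) (weaklyDecreasing β′) β↭β′
  ν+α↭ν+α′ : addParts (parts ν) (parts α) ↭ addParts (parts ν) (parts α′)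
  ν+α↭ν+α′ = ↭-cancelʳ (parts β) (↭-trans ext↭ (↭-reflexive (cong (_ ++_) (sym β≡β′))))
  α≡α′ : parts α ≡ parts α′
  α≡α′ = addParts-injective (parts ν) (positive α) (positive α′)
    (decreasing-↭⇒≡ (addParts-decreasing (weaklyDecreasing ν) (weaklyDecreasing α))
                    (addParts-decreasing (weaklyDecreasing ν) (weaklyDecreasing α′)) ν+α↭ν+α′)
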